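{- Let $p$ be a prime, $a$ an integer, and $i \in \{0,1,\ldots,p-1\}$. If $j$ is an integer with $0 < j < p - i$, then $$\binom{pa + i}{p^{\lambda} m - j} \equiv 0 \pmod{p^{\lambda}}$$ for all positive integers $m$ and $\lambda$.
   Context: For an integer $N$ (possibly negative) and integer $k \geq 0$, $\binom{N}{k} = N(N-1)\cdots(N-k+1)/k!$. -}

module Defs where

open import Data.Nat as ℕ using (ℕ; zero; suc; _!)
open import Data.Nat.Properties using (_!≢0)
open import Data.Integer using (ℤ; +_; _+_; _-_; _*_)
open import Data.Integer.DivMod using (_/ℕ_)

falling : ℤ → ℕ → ℤ
falling N zero    = + 1
falling N (suc k) = N * falling (N - + 1) k

-- generalized binomial coefficient  (N choose k) = N(N-1)...(N-k+1)/k!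
-- for integer N and natural k (the division is exact).
choose : ℤ → ℕ → ℤ
choose N k = _/ℕ_ (falling N k) (k !) {{k !≢0}}

module Submission where

-- Proof strategy.  Put  N = p·a + i,  K = p^λ·m  and  k = K − j, so that 0 ≤ k < K.
-- Write  C = (N choose k)  and  F = (N−k)(N−k−1)⋯(N−k−j+1) = falling (N − k) j.
--
--  1. Falling factorials split as  N⁽ᵏ⁺ʲ⁾ = N⁽ᵏ⁾ · (N−k)⁽ʲ⁾  and obey a Pascal-type
--     rule, from which k! ∣ N⁽ᵏ⁾ for every integer N; hence  choose N k · k! = N⁽ᵏ⁾.
--  2. Comparing  C · F · k! = N⁽ᴷ⁾ = (N choose K) · K!  and using  k! ∣ (K−1)!
--     gives  K ∣ C · F  whenever j > 0  (choose-split-∣).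
--  3. N − k = p·(a − p^(λ−1)·m) + (j + i) with j + i < p  (residue-shift), so the
--     factors of F have residues i+j, …, i+1, all in (0, p), and p ∤ F  (falling-∤).
--  4. p^λ ∣ K ∣ C · F and p ∤ F, hence p^λ ∣ C  (prime-power-∣-cancel).

open import Defs
open import Data.Nat using (ℕ; _<_; _^_; _∸_) renaming (_+_ to _+ℕ_; _*_ to _*ℕ_)
open import Data.Nat.Primality using (Prime)
open import Data.Integer using (ℤ; +_; _+_; _*_)
open import Data.Integer.Divisibility using (_∣_)

open import Data.Nat as ℕ using (zero; suc; _!; _≤_; NonZero)
import Data.Nat.Properties as ℕₚ
open import Data.Nat.Divisibility using (divides; m≤n⇒m!∣n!) renaming (_∣_ to _∣ℕ_)
import Data.Nat.Divisibility as ℕᵈ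
open import Data.Nat.Primality using (euclidsLemma; prime⇒nonZero; prime⇒nonTrivial)
open import Data.Integer using (-[1+_]; _-_; ∣_∣; _/ℕ_; _%ℕ_)
open import Data.Integer.Properties
open import Data.Integer.Divisibility.Signed as ℤˢ using () renaming (_∣_ to _∣ˢ_)
open import Data.Integer.DivMod using (a≡a%ℕn+[a/ℕn]*n)
open import Data.Integer.Tactic.RingSolver using (solve-∀)
open import Data.Sum using (inj₁; inj₂)
open import Data.Empty using (⊥-elim)
open import Relation.Nullary using (¬_)
open import Relation.Binary.PropositionalEquality
open ≡-Reasoning

pred-minus : ∀ N k → N - + 1 - + k ≡ N - + suc k
pred-minus N k = trans (shift N (+ k)) (cong (N -_) (sym (pos-+ 1 k)))
  where
  shift : ∀ N K → N - + 1 - K ≡ N - (+ 1 + K)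
  shift = solve-∀

falling-+ : ∀ N k j → falling N (k +ℕ j) ≡ falling N k * falling (N - + k) j
falling-+ N zero    j = sym (trans (*-identityˡ _) (cong (λ M → falling M j) (+-identityʳ N)))
falling-+ N (suc k) j = begin
  N * falling (N - + 1) (k +ℕ j)                        ≡⟨ cong (N *_) (falling-+ (N - + 1) k j) ⟩
  N * (falling (N - + 1) k * falling (N - + 1 - + k) j) ≡⟨ cong (λ M → N * (falling (N - + 1) k * falling M j)) (pred-minus N k) ⟩
  N * (falling (N - + 1) k * falling (N - + suc k) j)   ≡⟨ *-assoc N _ _ ⟨
  N * falling (N - + 1) k * falling (N - + suc k) j     ∎

falling-suc : ∀ N k → falling N (suc k) ≡ falling N k * (N - + k)
falling-suc N k = begin
  falling N (suc k)             ≡⟨ cong (falling N) (ℕₚ.+-comm 1 k) ⟩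
  falling N (k +ℕ 1)            ≡⟨ falling-+ N k 1 ⟩
  falling N k * ((N - + k) * + 1) ≡⟨ cong (falling N k *_) (*-identityʳ _) ⟩
  falling N k * (N - + k)       ∎

falling-pascal : ∀ N k → falling (N + + 1) (suc k) ≡ falling N (suc k) + + suc k * falling N k
falling-pascal N k = begin
  (N + + 1) * falling (N + + 1 - + 1) k                 ≡⟨ cong (λ M → (N + + 1) * falling M k) (cancel N) ⟩
  (N + + 1) * falling N k                               ≡⟨ regroup N (+ k) (falling N k) ⟩
  falling N k * (N - + k) + (+ 1 + + k) * falling N k   ≡⟨ cong (_+ (+ 1 + + k) * falling N k) (falling-suc N k) ⟨
  falling N (suc k) + + suc k * falling N k             ∎
  where
  cancel : ∀ N → N + + 1 - + 1 ≡ N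
  cancel = solve-∀
  regroup : ∀ N K F → (N + + 1) * F ≡ F * (N - K) + (+ 1 + K) * F
  regroup = solve-∀

ℤ-step-induction : (P : ℤ → Set) → P (+ 0) →
                   (∀ N → P N → P (N + + 1)) → (∀ N → P (N + + 1) → P N) → ∀ N → P N
ℤ-step-induction P P0 up down = go
  where
  go : ∀ N → P N
  go (+ zero)        = P0
  go (+ suc n)       = subst P (trans (sym (pos-+ n 1)) (cong +_ (ℕₚ.+-comm n 1))) (up (+ n) (go (+ n)))
  go -[1+ zero ]     = down -[1+ zero ] P0
  go -[1+ suc n ]    = down -[1+ suc n ] (go -[1+ n ])

-- k! divides N(N−1)…(N−k+1) for every integer N: by Pascal's rule the property
-- passes between N and N + 1, and it holds at N = 0 where the product vanishes.
factorial-∣-falling : ∀ k N → + (k !) ∣ˢ falling N k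
factorial-∣-falling zero    N = ℤˢ.divides (falling N zero) (sym (*-identityʳ _))
factorial-∣-falling (suc k) = ℤ-step-induction Q (ℤˢ.divides (+ 0) refl) up down
  where
  Q : ℤ → Set
  Q N = + (suc k !) ∣ˢ falling N (suc k)
  ∣-correction : ∀ N → + (suc k !) ∣ˢ + suc k * falling N k
  ∣-correction N = subst (_∣ˢ + suc k * falling N k) (sym (pos-* (suc k) (k !)))
                     (ℤˢ.*-monoʳ-∣ (+ suc k) (factorial-∣-falling k N))
  up : ∀ N → Q N → Q (N + + 1)
  up N q = subst (+ (suc k !) ∣ˢ_) (sym (falling-pascal N k)) (ℤˢ.∣m∣n⇒∣m+n q (∣-correction N))
  down : ∀ N → Q (N + + 1) → Q N
  down N q = ℤˢ.∣m+n∣n⇒∣m (subst (+ (suc k !) ∣ˢ_) (falling-pascal N k) q) (∣-correction N)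

/ℕ-exact : ∀ z d .{{_ : NonZero d}} → + d ∣ z → (z /ℕ d) * + d ≡ z
/ℕ-exact z d d∣z = sym (begin
  z                             ≡⟨ a≡a%ℕn+[a/ℕn]*n z d ⟩
  + (z %ℕ d) + (z /ℕ d) * + d   ≡⟨ cong (λ r → + r + (z /ℕ d) * + d) (remainder-zero z d∣z) ⟩
  + 0 + (z /ℕ d) * + d          ≡⟨ +-identityˡ _ ⟩
  (z /ℕ d) * + d                ∎)
  where
  remainder-zero : ∀ z → + d ∣ z → z %ℕ d ≡ 0
  remainder-zero (+ n)    d∣n = ℕᵈ.n∣m⇒m%n≡0 n d d∣n
  remainder-zero -[1+ n ] d∣n with suc n ℕ.% d | ℕᵈ.n∣m⇒m%n≡0 (suc n) d d∣n
  ... | zero | _ = refl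

choose-spec : ∀ N k → choose N k * + (k !) ≡ falling N k
choose-spec N k = /ℕ-exact (falling N k) (k !) {{k ℕₚ.!≢0}} (ℤˢ.∣⇒∣ᵤ (factorial-∣-falling k N))

-- For j > 0:  (k + j) ∣ (N choose k) · (N − k)⁽ʲ⁾.  Indeed this product times k!
-- is N⁽ᵏ⁺ʲ⁾ = (N choose k+j) · (k+j) · (k+j−1)!, and k! ∣ (k+j−1)!.
choose-split-∣ : ∀ N k j → 0 < j → + (k +ℕ j) ∣ˢ choose N k * falling (N - + k) j
choose-split-∣ N k (suc j) _ with m≤n⇒m!∣n! (ℕₚ.m≤m+n k j)
... | divides r k+j!≡r*k! = subst (λ n → + n ∣ˢ C * F) (sym (ℕₚ.+-suc k j))
  (ℤˢ.divides (choose N K * + r) (*-cancelʳ-≡ _ _ (+ (k !)) {{k ℕₚ.!≢0}} (begin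
    C * F * + (k !)                       ≡⟨ swap C F (+ (k !)) ⟩
    C * + (k !) * F                       ≡⟨ cong (_* F) (choose-spec N k) ⟩
    falling N k * F                       ≡⟨ falling-+ N k (suc j) ⟨
    falling N (k +ℕ suc j)                ≡⟨ cong (falling N) (ℕₚ.+-suc k j) ⟩
    falling N K                           ≡⟨ choose-spec N K ⟨
    choose N K * + (K *ℕ (k +ℕ j) !)      ≡⟨ cong (λ x → choose N K * + (K *ℕ x)) k+j!≡r*k! ⟩
    choose N K * + (K *ℕ (r *ℕ k !))      ≡⟨ cong (choose N K *_) (trans (pos-* K _) (cong (+ K *_) (pos-* r (k !)))) ⟩
    choose N K * (+ K * (+ r * + (k !)))  ≡⟨ regroup (choose N K) (+ K) (+ r) (+ (k !)) ⟩
    choose N K * + r * + K * + (k !)      ∎)))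
  where
  K = suc (k +ℕ j)
  C = choose N k
  F = falling (N - + k) (suc j)
  swap : ∀ C F X → C * F * X ≡ C * X * F
  swap = solve-∀
  regroup : ∀ D K R X → D * (K * (R * X)) ≡ D * R * K * X
  regroup = solve-∀

residue-shift : ∀ {P X K} a i j → K ≡ P *ℕ X → j ≤ K →
                + P * a + + i - + (K ∸ j) ≡ + P * (a - + X) + + (j +ℕ i)
residue-shift {P} {X} {K} a i j K≡PX j≤K = begin
  + P * a + + i - + (K ∸ j)               ≡⟨ cong (λ z → + P * a + + i - z) K-j≡PX-j ⟩
  + P * a + + i - (+ P * + X - + j)       ≡⟨ regroup (+ P) a (+ i) (+ X) (+ j) ⟩
  + P * (a - + X) + (+ j + + i)           ∎
  where
  add-sub : ∀ k j → k ≡ k + j - j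
  add-sub = solve-∀
  regroup : ∀ P A I X J → P * A + I - (P * X - J) ≡ P * (A - X) + (J + I)
  regroup = solve-∀
  K-j≡PX-j : + (K ∸ j) ≡ + P * + X - + j
  K-j≡PX-j = begin
    + (K ∸ j)                 ≡⟨ add-sub (+ (K ∸ j)) (+ j) ⟩
    + (K ∸ j) + + j - + j     ≡⟨ cong (λ n → + n - + j) (trans (ℕₚ.m∸n+n≡m j≤K) K≡PX) ⟩
    + (P *ℕ X) - + j          ≡⟨ cong (_- + j) (pos-* P X) ⟩
    + P * + X - + j           ∎

module _ {p : ℕ} (p-prime : Prime p) where
  private instance
    p≢0 : NonZero p
    p≢0 = prime⇒nonZero p-prime
    p≢1 : ℕ.NonTrivial p
    p≢1 = prime⇒nonTrivial p-prime

  residue-∤ : ∀ b r → 0 < r → r < p → ¬ + p ∣ + p * b + + r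
  residue-∤ b r 0<r r<p p∣pb+r = ℕₚ.<⇒≱ r<p (ℕᵈ.∣⇒≤ {{ℕ.>-nonZero 0<r}} (ℤˢ.∣⇒∣ᵤ p∣r))
    where
    p∣r : + p ∣ˢ + r
    p∣r = ℤˢ.∣m+n∣m⇒∣n (ℤˢ.∣ᵤ⇒∣ p∣pb+r) (ℤˢ.∣m⇒∣m*n b ℤˢ.∣-refl)

  -- If j ≤ r < p, the j factors of (pb + r)⁽ʲ⁾ have residues r, r−1, …, r−j+1, all
  -- in (0, p), so by Euclid's lemma p does not divide their product.
  falling-∤ : ∀ b r j → j ≤ r → r < p → ¬ + p ∣ falling (+ p * b + + r) j
  falling-∤ b r       zero    _         _   p∣1 = ℕ.nonTrivial⇒≢1 (ℕᵈ.∣1⇒≡1 p∣1)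
  falling-∤ b (suc r) (suc j) (ℕ.s≤s j≤r) r<p p∣xy
    with euclidsLemma ∣ x ∣ ∣ y ∣ p-prime (subst (p ∣ℕ_) (abs-* x y) p∣xy)
    where
    x = + p * b + + suc r
    y = falling (x - + 1) j
  ... | inj₁ p∣x = residue-∤ b (suc r) ℕ.z<s r<p p∣x
  ... | inj₂ p∣y = falling-∤ b r j j≤r (ℕₚ.<-trans (ℕₚ.n<1+n r) r<p)
                     (subst (λ M → + p ∣ falling M j) (predecessor (+ p * b) (+ r)) p∣y)
    where
    predecessor : ∀ B R → B + (+ 1 + R) - + 1 ≡ B + R
    predecessor = solve-∀

  prime-power-∣-cancel : ∀ e c f → p ^ e ∣ℕ c *ℕ f → ¬ p ∣ℕ f → p ^ e ∣ℕ c
  prime-power-∣-cancel zero    c f _     _   = ℕᵈ.1∣ c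
  prime-power-∣-cancel (suc e) c f pᵉ⁺¹∣cf p∤f
    with euclidsLemma c f p-prime (ℕᵈ.∣-trans (ℕᵈ.m∣m*n (p ^ e)) pᵉ⁺¹∣cf)
  ... | inj₂ p∣f = ⊥-elim (p∤f p∣f)
  ... | inj₁ (divides c′ refl) =
    subst (p ^ suc e ∣ℕ_) (ℕₚ.*-comm p c′) (ℕᵈ.*-monoʳ-∣ p (prime-power-∣-cancel e c′ f pᵉ∣c′f p∤f))
    where
    pᵉ∣c′f : p ^ e ∣ℕ c′ *ℕ f
    pᵉ∣c′f = ℕᵈ.*-cancelˡ-∣ p (subst (p ^ suc e ∣ℕ_) (trans (cong (_*ℕ f) (ℕₚ.*-comm c′ p)) (ℕₚ.*-assoc p c′ f)) pᵉ⁺¹∣cf)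

lemma6 : (p : ℕ) → Prime p → (a : ℤ) → (i : ℕ) → i < p →
    (j : ℕ) → 0 < j → j +ℕ i < p →
    (m λ′ : ℕ) → 0 < m → 0 < λ′ →
    (+ (p ^ λ′)) ∣ choose (+ p * a + + i) (p ^ λ′ *ℕ m ∸ j)
lemma6 p p-prime a i _ j 0<j j+i<p m (suc l) 0<m _ =
  prime-power-∣-cancel p-prime (suc l) ∣ C ∣ ∣ F ∣ pˡ⁺¹∣CF p∤F
  where
  instance
    X≢0 : NonZero (p ^ l *ℕ m)
    X≢0 = ℕₚ.m*n≢0 (p ^ l) m {{ℕₚ.m^n≢0 p l {{prime⇒nonZero p-prime}}}} {{ℕ.>-nonZero 0<m}}
  N = + p * a + + i
  X = p ^ l *ℕ m
  K = p ^ suc l *ℕ m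
  k = K ∸ j
  C = choose N k
  F = falling (N - + k) j
  K≡pX : K ≡ p *ℕ X
  K≡pX = ℕₚ.*-assoc p (p ^ l) m
  j≤K : j ≤ K
  j≤K = ℕₚ.<⇒≤ (ℕₚ.<-≤-trans (ℕₚ.≤-<-trans (ℕₚ.m≤m+n j i) j+i<p)
                             (subst (p ≤_) (sym K≡pX) (ℕₚ.m≤m*n p X)))
  pˡ⁺¹∣CF : p ^ suc l ∣ℕ ∣ C ∣ *ℕ ∣ F ∣
  pˡ⁺¹∣CF = ℕᵈ.∣-trans (ℕᵈ.m∣m*n m)
    (subst₂ _∣ℕ_ (ℕₚ.m∸n+n≡m j≤K) (abs-* C F) (ℤˢ.∣⇒∣ᵤ (choose-split-∣ N k j 0<j)))
  p∤F : ¬ p ∣ℕ ∣ F ∣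
  p∤F p∣F = falling-∤ p-prime (a - + X) (j +ℕ i) j (ℕₚ.m≤m+n j i) j+i<p
    (subst (λ M → + p ∣ falling M j) (residue-shift {p} {X} {K} a i j K≡pX j≤K) p∣F)
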